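{- Let $M$ be a matroid with dual matroid $M^\ast$. Then $F(M,\mathbf{x})=\sum_\alpha c_\alpha M_\alpha$ if and only if $F(M^\ast,\mathbf{x})=\sum_\alpha c_\alpha M_{\alpha^\ast}$, where for a composition $\alpha=(\alpha_1,\ldots,\alpha_k)$ we write $\alpha^\ast=(\alpha_k,\alpha_{k-1},\ldots,\alpha_1)$ for the reversed composition.
   Context: For a matroid $M$ on finite ground set $E$ with bases $\mathcal{B}(M)$ and $f:E\to\mathbb{P}=\{1,2,\ldots\}$, $f$ is $M$-generic if the minimum of $f(B)=\sum_{e\in B}f(e)$ over bases is attained by a unique base; $F(M,\mathbf{x})=\sum_{f\ M\text{ -generic}}\prod_{e\in E}x_{f(e)}$. The dual matroid $M^\ast$ has ground set $E$ and bases $\{E\setminus B: B\in\mathcal{B}(M)\}$. For a composition $\alpha=(\alpha_1,\ldots,\alpha_k)$, $M_\alpha=\sum_{i_1<\cdots<i_k}x_{i_1}^{\alpha_1}\cdots x_{i_k}^{\alpha_k}$ is the monomial quasisymmetric function; these form a basis of the quasisymmetric functions. -}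

module Defs where

open import Data.Nat using (ℕ; zero; suc; _+_; _∸_; _<_; _≟_)
open import Data.Nat.Properties using (_<?_)
open import Data.Bool using (Bool; if_then_else_)
open import Data.Fin using (Fin; toℕ)
import Data.Fin.Properties as FinP
open import Data.Fin.Subset using (Subset; _∈_; _∉_; ∁; _-_; _∪_; ⁅_⁆)
open import Data.Fin.Subset.Properties using (anySubset?)
open import Data.Vec using (Vec; lookup; toList)
import Data.Vec.Properties as VecP
import Data.Bool.Properties as BoolP
open import Data.Vec.Functional using () renaming (_∷_ to _∷ᶠ_)
open import Data.List using (List; []; _∷_; length; filter; map; concatMap; allFin; upTo)
open import Data.Nat.ListAction using (sum)
import Data.List.Properties as ListP
open import Data.Integer using (ℤ; +_; _*_)
import Data.Integer as ℤ
open import Data.Product using (Σ; ∃; ∃-syntax; _×_; _,_)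
open import Relation.Nullary using (Dec; yes; no; ¬_; ¬?; _×-dec_; _→-dec_)
open import Relation.Nullary.Decidable using (Dec; does)
open import Relation.Unary using (Pred; Decidable)
open import Relation.Binary.PropositionalEquality using (_≡_; _≢_)
open import Level using (0ℓ)

record Matroid (n : ℕ) : Set₁ where
  field
    IsBase   : Pred (Subset n) 0ℓ
    isBase?  : Decidable IsBase
    base-exists : ∃[ B ] IsBase B
    exchange : ∀ B₁ B₂ → IsBase B₁ → IsBase B₂ →
               ∀ x → x ∈ B₁ → x ∉ B₂ →
               ∃[ y ] (y ∈ B₂ × y ∉ B₁ × IsBase ((B₁ - x) ∪ ⁅ y ⁆))

open Matroid public

IsDual : ∀ {n} → Matroid n → Matroid n → Set
IsDual M M* = ∀ B → (IsBase M* B → IsBase M (∁ B)) × (IsBase M (∁ B) → IsBase M* B)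

-- Generic functions.  A function f : E → ℙ with values in {1,…,k} is
-- represented by f : Fin n → Fin k, the value of f(e) being toℕ (f e) + 1.

weight : ∀ {n k} → (Fin n → Fin k) → Subset n → ℕ
weight {n} f B = sum (map (λ e → if lookup B e then suc (toℕ (f e)) else 0) (allFin n))

Generic : ∀ {n k} → Matroid n → (Fin n → Fin k) → Set
Generic M f = ∃[ B ] (IsBase M B × (∀ B′ → IsBase M B′ → B′ ≢ B → weight f B < weight f B′))

allSubset? : ∀ {n} {P : Pred (Subset n) 0ℓ} → Decidable P → Dec (∀ B → P B)
allSubset? P? with anySubset? (λ B → ¬? (P? B))
... | yes (B , ¬PB) = no (λ h → ¬PB (h B))
... | no ¬∃ = yes (λ B → helper B)
  where
  helper : ∀ B → _
  helper B with P? B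
  ... | yes p = p
  ... | no ¬p = Data.Empty.⊥-elim (¬∃ (B , ¬p))
    where import Data.Empty

_≟S_ : ∀ {n} (A B : Subset n) → Dec (A ≡ B)
_≟S_ = VecP.≡-dec BoolP._≟_

generic? : ∀ {n k} (M : Matroid n) → Decidable (Generic {n} {k} M)
generic? M f = anySubset? (λ B → isBase? M B ×-dec
  allSubset? (λ B′ → isBase? M B′ →-dec (¬? (B′ ≟S B) →-dec (weight f B <? weight f B′))))

fiber : ∀ {n k} → (Fin n → Fin k) → Fin k → ℕ
fiber {n} f i = length (filter (λ e → f e FinP.≟ i) (allFin n))

allFuns : (n k : ℕ) → List (Fin n → Fin k)
allFuns zero    k = (λ ()) ∷ []
allFuns (suc n) k = concatMap (λ g → map (λ i → i ∷ᶠ g) (allFin k)) (allFuns n k)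

-- Formal power series in x₁, x₂, … with integer coefficients are
-- compared coefficientwise; a monomial x₁^{m₁}⋯x_k^{m_k} is given by
-- an exponent vector m : Vec ℕ k (trailing zeros allowed).

-- coefficient of x^m in F(M,x) = number of M-generic f with |f⁻¹(i)| = mᵢ
-- (such f necessarily take values in {1,…,k}).
coeffF : ∀ {n} → Matroid n → (k : ℕ) → Vec ℕ k → ℤ
coeffF {n} M k m = + length (filter (λ f → FinP.all? (λ i → fiber f i ≟ lookup m i)
                                             ×-dec generic? M f) (allFuns n k))

-- Compositions are lists of positive integers.
Composition : Set
Composition = List ℕ

compsF : ℕ → ℕ → List Composition
compsF _          zero    = [] ∷ []
compsF zero       (suc d) = []
compsF (suc fuel) (suc d) =
  concatMap (λ a → map (λ α → suc a ∷ α) (compsF fuel (d ∸ a))) (upTo (suc d))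

compositions : ℕ → List Composition
compositions d = compsF d d

flat : ∀ {k} → Vec ℕ k → Composition
flat m = filter (λ x → ¬? (x ≟ 0)) (toList m)

-- coefficient of x^m in M_α: 1 if the nonzero exponents of m, in order, are α
coeffM : Composition → ∀ {k} → Vec ℕ k → ℤ
coeffM α m with ListP.≡-dec _≟_ (flat m) α
... | yes _ = + 1
... | no  _ = + 0

-- coefficient of x^m in Σ_α c_α M_{g(α)}, for g = id or reversal
-- (only compositions α of |m| = Σ mᵢ can contribute, as g preserves size)
coeffLin : (Composition → ℤ) → (Composition → Composition) → (k : ℕ) → Vec ℕ k → ℤ
coeffLin c g k m = Data.List.foldr ℤ._+_ (+ 0)
  (map (λ α → c α * coeffM (g α) m) (compositions (Data.Vec.sum m)))
  where import Data.List; import Data.Vec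

_≈ₛ_ : ((k : ℕ) → Vec ℕ k → ℤ) → ((k : ℕ) → Vec ℕ k → ℤ) → Set
F ≈ₛ G = ∀ k m → F k m ≡ G k m

-- All bases of a matroid have the same size r (basis exchange). Encode f : E → {1,…,k} and let
-- f̄ = k + 1 − f. Then f(E ∖ B) = f(E) − (k+1) r + f̄(B) for every base B of M, so complementation
-- carries the f̄-minimal bases of M onto the f-minimal bases of M*: f is M*-generic iff f̄ is
-- M-generic. Since f ↦ f̄ is a bijection reversing the fibre sizes (m₁,…,m_k) ↦ (m_k,…,m₁), the
-- coefficient of x^m in F(M*) is that of x^(rev m) in F(M), while x^m occurs in M_{α*} exactly
-- when x^(rev m) occurs in M_α.
module Submission where

open import Defs
open import Level using (0ℓ)
open import Data.Nat using (ℕ; zero; suc; _+_; _*_; _<_; _∸_)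
open import Data.Nat.Properties
  using ( +-0-commutativeMonoid; +-commutativeSemigroup; +-comm; +-suc; +-identityʳ
        ; +-cancelʳ-≡; +-cancelʳ-<; +-monoˡ-<; *-suc; *-zeroʳ; *-identityˡ; m+[n∸m]≡n; ≤-reflexive)
import Data.Nat.Properties as ℕₚ
open import Data.Nat.Induction using (<-wellFounded)
open import Data.Nat.ListAction using (sum)
open import Data.Nat.ListAction.Properties using (sum-++; sum-↭)
open import Data.Bool using (true; false; not; _∧_; _∨_; if_then_else_)
open import Data.Bool.Properties using (∧-identityʳ; ∧-zeroʳ; ∨-identityʳ)
open import Data.Fin using (Fin; zero; suc; toℕ; opposite; fromℕ; inject₁)
open import Data.Fin.Properties using (_≟_; any?; opposite-prop; toℕ<n)
open import Data.Fin.Permutation using (Permutation′; _⟨$⟩ʳ_; _⟨$⟩ˡ_; inverseʳ)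
import Data.Fin.Permutation as Permutation
open import Data.Fin.Subset using (Subset; _∈_; _∉_; ∁; _─_; _-_; _∪_; ⁅_⁆; ⊥; ∣_∣)
open import Data.Fin.Subset.Properties using (_∈?_; ⊆-antisym; ∪-∩-booleanAlgebra)
open import Data.Vec using (Vec; []; _∷_; _∷ʳ_; lookup; toList)
import Data.Vec as Vec
open import Data.Vec.Properties
  using ( lookup-map; lookup-zipWith; lookup-replicate; []=⇒lookup; lookup⇒[]=
        ; reverse-∷; reverse-involutive; toList-reverse)
open import Data.Vec.Functional using () renaming (_∷_ to _∷ᶠ_)
open import Data.List
  using (List; []; _∷_; [_]; _++_; map; tabulate; allFin; concatMap; filter; length; reverse; foldr)
open import Data.List.Properties
  using ( map-tabulate; map-++; map-∘; map-cong; filter-≐; filter-++; unfold-reverse; ++-identityʳ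
        ; reverse-selfInverse; ≡-dec)
open import Data.List.Relation.Binary.Permutation.Propositional.Properties using (↭-reverse)
open import Data.Integer using (ℤ)
import Data.Integer as ℤ
open import Data.Product using (_×_; _,_; proj₁; proj₂)
open import Data.Product.Function.NonDependent.Propositional using (_×-⇔_)
open import Algebra.Properties.CommutativeMonoid.Sum +-0-commutativeMonoid
  using (sum-syntax; ∑-distrib-+; sum-cong-≗; sum-permute)
open import Algebra.Properties.CommutativeSemigroup +-commutativeSemigroup using (x∙yz≈yx∙z)
import Algebra.Lattice.Properties.BooleanAlgebra as BooleanAlgebraProperties
open import Function using (_∘_; id; _⇔_; mk⇔; Equivalence; Injection)
open import Function.Properties.Inverse using (↔⇒↣)
open import Induction.WellFounded using (Acc; acc)
open import Relation.Unary using (Pred; Decidable)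
open import Relation.Nullary using (does; yes; no; ¬?; _×-dec_; contradiction)
open import Relation.Nullary.Decidable using (does-⇔; decidable-stable)
open import Relation.Binary.PropositionalEquality
  using (_≡_; refl; sym; trans; cong; cong₂; subst; subst₂; _≗_; module ≡-Reasoning)
open ≡-Reasoning

private variable
  n k : ℕ
  A C : Set

sum-map-allFin : (u : Fin n → ℕ) → sum (map u (allFin n)) ≡ ∑[ i < n ] u i
sum-map-allFin u = trans (cong sum (map-tabulate id u)) (sum-tabulate u)
  where
  sum-tabulate : ∀ {n} (u : Fin n → ℕ) → sum (tabulate u) ≡ ∑[ i < n ] u i
  sum-tabulate {zero}  u = refl
  sum-tabulate {suc n} u = cong (u zero +_) (sum-tabulate (u ∘ suc))

restrict : (Fin n → ℕ) → Subset n → Fin n → ℕ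
restrict w B e = if lookup B e then w e else 0

subsetSum : (Fin n → ℕ) → Subset n → ℕ
subsetSum {n} w B = ∑[ e < n ] restrict w B e

subsetSum-cong : {u v : Fin n → ℕ} → u ≗ v → (B : Subset n) → subsetSum u B ≡ subsetSum v B
subsetSum-cong u≗v B = sum-cong-≗ (λ e → cong (if lookup B e then_else 0) (u≗v e))

subsetSum-⊥ : (w : Fin n → ℕ) → subsetSum w ⊥ ≡ 0
subsetSum-⊥ {zero}  w = refl
subsetSum-⊥ {suc n} w = subsetSum-⊥ (w ∘ suc)

subsetSum-⁅⁆ : (w : Fin n → ℕ) (x : Fin n) → subsetSum w ⁅ x ⁆ ≡ w x
subsetSum-⁅⁆ w zero    = trans (cong (w zero +_) (subsetSum-⊥ (w ∘ suc))) (+-identityʳ (w zero))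
subsetSum-⁅⁆ w (suc x) = subsetSum-⁅⁆ (w ∘ suc) x

subsetSum-+ : (u v : Fin n → ℕ) (B : Subset n) →
              subsetSum (λ e → u e + v e) B ≡ subsetSum u B + subsetSum v B
subsetSum-+ u v B = trans (sum-cong-≗ restrict-+) (∑-distrib-+ (restrict u B) (restrict v B))
  where
  restrict-+ : ∀ e → restrict (λ e → u e + v e) B e ≡ restrict u B e + restrict v B e
  restrict-+ e with lookup B e
  ... | true  = refl
  ... | false = refl

subsetSum-const : (c : ℕ) (B : Subset n) → subsetSum (λ _ → c) B ≡ c * ∣ B ∣
subsetSum-const c []          = sym (*-zeroʳ c)
subsetSum-const c (true ∷ B)  = trans (cong (c +_) (subsetSum-const c B)) (sym (*-suc c ∣ B ∣))
subsetSum-const c (false ∷ B) = subsetSum-const c B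

subsetSum-∁ : (w : Fin n → ℕ) (B : Subset n) → subsetSum w B + subsetSum w (∁ B) ≡ ∑[ e < n ] w e
subsetSum-∁ w B =
  trans (sym (∑-distrib-+ (restrict w B) (restrict w (∁ B)))) (sum-cong-≗ restrict-∁)
  where
  restrict-∁ : ∀ e → restrict w B e + restrict w (∁ B) e ≡ w e
  restrict-∁ e rewrite lookup-map e not B with lookup B e
  ... | true  = +-identityʳ _
  ... | false = refl

lookup-⁅⁆ : (x e : Fin n) → lookup ⁅ x ⁆ e ≡ does (e ≟ x)
lookup-⁅⁆ zero    zero    = refl
lookup-⁅⁆ zero    (suc e) = lookup-replicate e false
lookup-⁅⁆ (suc x) zero    = refl
lookup-⁅⁆ (suc x) (suc e) = lookup-⁅⁆ x e

lookup-─ : (p q : Subset n) (e : Fin n) → lookup (p ─ q) e ≡ lookup p e ∧ not (lookup q e)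
lookup-─ (a ∷ p) (true  ∷ q) zero    = sym (∧-zeroʳ a)
lookup-─ (a ∷ p) (false ∷ q) zero    = sym (∧-identityʳ a)
lookup-─ (a ∷ p) (b     ∷ q) (suc e) = lookup-─ p q e

lookup-exchange : (B : Subset n) (x y e : Fin n) →
                  lookup ((B - x) ∪ ⁅ y ⁆) e ≡ (lookup B e ∧ not (does (e ≟ x))) ∨ does (e ≟ y)
lookup-exchange B x y e = begin
  lookup ((B - x) ∪ ⁅ y ⁆) e
    ≡⟨ lookup-zipWith _∨_ e (B - x) ⁅ y ⁆ ⟩
  lookup (B ─ ⁅ x ⁆) e ∨ lookup ⁅ y ⁆ e
    ≡⟨ cong₂ _∨_ (lookup-─ B ⁅ x ⁆ e) (lookup-⁅⁆ y e) ⟩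
  (lookup B e ∧ not (lookup ⁅ x ⁆ e)) ∨ does (e ≟ y)
    ≡⟨ cong (λ b → (lookup B e ∧ not b) ∨ does (e ≟ y)) (lookup-⁅⁆ x e) ⟩
  (lookup B e ∧ not (does (e ≟ x))) ∨ does (e ≟ y) ∎

∉⇒lookup≡false : {x : Fin n} {B : Subset n} → x ∉ B → lookup B x ≡ false
∉⇒lookup≡false {x = x} {B} x∉B with lookup B x in eq
... | true  = contradiction (lookup⇒[]= x B eq) x∉B
... | false = refl

subsetSum-exchange : (w : Fin n → ℕ) {B : Subset n} {x y : Fin n} → x ∈ B → y ∉ B →
                     subsetSum w ((B - x) ∪ ⁅ y ⁆) + w x ≡ subsetSum w B + w y
subsetSum-exchange {n} w {B} {x} {y} x∈B y∉B = begin
  subsetSum w B′ + w x                               ≡⟨ cong (subsetSum w B′ +_) (subsetSum-⁅⁆ w x) ⟨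
  subsetSum w B′ + subsetSum w ⁅ x ⁆                 ≡⟨ ∑-distrib-+ (restrict w B′) (restrict w ⁅ x ⁆) ⟨
  ∑[ e < n ] (restrict w B′ e + restrict w ⁅ x ⁆ e)  ≡⟨ sum-cong-≗ pointwise ⟩
  ∑[ e < n ] (restrict w B e + restrict w ⁅ y ⁆ e)   ≡⟨ ∑-distrib-+ (restrict w B) (restrict w ⁅ y ⁆) ⟩
  subsetSum w B + subsetSum w ⁅ y ⁆                  ≡⟨ cong (subsetSum w B +_) (subsetSum-⁅⁆ w y) ⟩
  subsetSum w B + w y                                ∎
  where
  B′ = (B - x) ∪ ⁅ y ⁆
  pointwise : ∀ e → restrict w B′ e + restrict w ⁅ x ⁆ e ≡ restrict w B e + restrict w ⁅ y ⁆ e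
  pointwise e rewrite lookup-exchange B x y e | lookup-⁅⁆ x e | lookup-⁅⁆ y e
    with e ≟ x | e ≟ y
  ... | yes refl | yes refl = contradiction x∈B y∉B
  ... | yes refl | no _ rewrite []=⇒lookup x∈B = sym (+-identityʳ (w x))
  ... | no _ | yes refl rewrite ∉⇒lookup≡false y∉B = +-identityʳ (w y)
  ... | no _ | no _ rewrite ∧-identityʳ (lookup B e) | ∨-identityʳ (lookup B e) = refl

∣exchange∣ : {B : Subset n} {x y : Fin n} → x ∈ B → y ∉ B → ∣ (B - x) ∪ ⁅ y ⁆ ∣ ≡ ∣ B ∣
∣exchange∣ {B = B} {x} {y} x∈B y∉B = +-cancelʳ-≡ 1 _ _ (begin
  ∣ (B - x) ∪ ⁅ y ⁆ ∣ + 1                    ≡⟨ cong (_+ 1) (subsetSum-∣∣ ((B - x) ∪ ⁅ y ⁆)) ⟨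
  subsetSum (λ _ → 1) ((B - x) ∪ ⁅ y ⁆) + 1  ≡⟨ subsetSum-exchange (λ _ → 1) x∈B y∉B ⟩
  subsetSum (λ _ → 1) B + 1                  ≡⟨ cong (_+ 1) (subsetSum-∣∣ B) ⟩
  ∣ B ∣ + 1                                  ∎)
  where
  subsetSum-∣∣ : (B : Subset n) → subsetSum (λ _ → 1) B ≡ ∣ B ∣
  subsetSum-∣∣ B = trans (subsetSum-const 1 B) (*-identityˡ ∣ B ∣)

module _ (M : Matroid n) where

  bases-equicardinal : {B₁ B₂ : Subset n} → IsBase M B₁ → IsBase M B₂ → ∣ B₁ ∣ ≡ ∣ B₂ ∣
  bases-equicardinal {B₁} {B₂} b₁ b₂ = go b₁ (<-wellFounded _)
    where
    outside : Fin n → ℕ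
    outside e = if lookup B₂ e then 0 else 1

    -- Induction on |B ∖ B₂|: basis exchange lowers it by one, and once it is 0,
    -- exchange also forces B₂ ⊆ B.
    go : {B : Subset n} → IsBase M B → Acc _<_ (subsetSum outside B) → ∣ B ∣ ≡ ∣ B₂ ∣
    go {B} b (acc rec) with any? (λ e → e ∈? B ×-dec ¬? (e ∈? B₂))
    ... | yes (x , x∈B , x∉B₂) with exchange M B B₂ b b₂ x x∈B x∉B₂
    ...   | y , y∈B₂ , y∉B , b′ = trans (sym (∣exchange∣ x∈B y∉B)) (go b′ (rec fewer-outside))
      where
      B′ = (B - x) ∪ ⁅ y ⁆
      fewer-outside : subsetSum outside B′ < subsetSum outside B
      fewer-outside = ≤-reflexive (begin
        suc (subsetSum outside B′)          ≡⟨ +-comm 1 _ ⟩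
        subsetSum outside B′ + 1            ≡⟨ cong (subsetSum outside B′ +_) outside-x ⟨
        subsetSum outside B′ + outside x    ≡⟨ subsetSum-exchange outside x∈B y∉B ⟩
        subsetSum outside B + outside y     ≡⟨ cong (subsetSum outside B +_) outside-y ⟩
        subsetSum outside B + 0             ≡⟨ +-identityʳ _ ⟩
        subsetSum outside B                 ∎)
        where
        outside-x : outside x ≡ 1
        outside-x rewrite ∉⇒lookup≡false x∉B₂ = refl
        outside-y : outside y ≡ 0
        outside-y rewrite []=⇒lookup y∈B₂ = refl
    go {B} b _ | no ¬B⊈B₂ = cong ∣_∣ (⊆-antisym B⊆B₂ B₂⊆B)
      where
      B⊆B₂ : ∀ {x} → x ∈ B → x ∈ B₂
      B⊆B₂ {x} x∈B = decidable-stable (x ∈? B₂) (λ x∉B₂ → ¬B⊈B₂ (x , x∈B , x∉B₂))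
      B₂⊆B : ∀ {x} → x ∈ B₂ → x ∈ B
      B₂⊆B {x} x∈B₂ = decidable-stable (x ∈? B) λ x∉B →
        let (y , y∈B , y∉B₂ , _) = exchange M B₂ B b₂ b x x∈B₂ x∉B in ¬B⊈B₂ (y , y∈B , y∉B₂)

value : Fin k → ℕ
value i = suc (toℕ i)

value+value-opposite : (i : Fin k) → value i + value (opposite i) ≡ suc k
value+value-opposite {k} i = begin
  suc (toℕ i) + suc (toℕ (opposite i)) ≡⟨ cong (λ j → suc (toℕ i) + suc j) (opposite-prop i) ⟩
  suc (toℕ i) + suc (k ∸ suc (toℕ i))  ≡⟨ +-suc (suc (toℕ i)) _ ⟩
  suc (suc (toℕ i) + (k ∸ suc (toℕ i))) ≡⟨ cong suc (m+[n∸m]≡n (toℕ<n i)) ⟩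
  suc k ∎

weight≡subsetSum : (f : Fin n → Fin k) (B : Subset n) → weight f B ≡ subsetSum (value ∘ f) B
weight≡subsetSum f B = sum-map-allFin (restrict (value ∘ f) B)

weight+weight-opposite : (f : Fin n → Fin k) (B : Subset n) →
                         weight f B + weight (opposite ∘ f) B ≡ suc k * ∣ B ∣
weight+weight-opposite {k = k} f B = begin
  weight f B + weight (opposite ∘ f) B
    ≡⟨ cong₂ _+_ (weight≡subsetSum f B) (weight≡subsetSum (opposite ∘ f) B) ⟩
  subsetSum (value ∘ f) B + subsetSum (value ∘ opposite ∘ f) B
    ≡⟨ subsetSum-+ (value ∘ f) (value ∘ opposite ∘ f) B ⟨
  subsetSum (λ e → value (f e) + value (opposite (f e))) B
    ≡⟨ subsetSum-cong (value+value-opposite ∘ f) B ⟩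
  subsetSum (λ _ → suc k) B
    ≡⟨ subsetSum-const (suc k) B ⟩
  suc k * ∣ B ∣ ∎

weight-∁ : (f : Fin n → Fin k) (B : Subset n) →
           weight f (∁ B) + suc k * ∣ B ∣ ≡ weight (opposite ∘ f) B + ∑[ e < n ] value (f e)
weight-∁ {n} {k} f B = begin
  weight f (∁ B) + suc k * ∣ B ∣                  ≡⟨ cong (weight f (∁ B) +_) (weight+weight-opposite f B) ⟨
  weight f (∁ B) + (weight f B + weight f̄ B)     ≡⟨ x∙yz≈yx∙z (weight f (∁ B)) (weight f B) (weight f̄ B) ⟩
  (weight f B + weight f (∁ B)) + weight f̄ B     ≡⟨ cong (_+ weight f̄ B) weight-split ⟩
  ∑[ e < n ] value (f e) + weight f̄ B            ≡⟨ +-comm _ (weight f̄ B) ⟩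
  weight f̄ B + ∑[ e < n ] value (f e)            ∎
  where
  f̄ = opposite ∘ f
  weight-split : weight f B + weight f (∁ B) ≡ ∑[ e < n ] value (f e)
  weight-split = trans (cong₂ _+_ (weight≡subsetSum f B) (weight≡subsetSum f (∁ B)))
                       (subsetSum-∁ (value ∘ f) B)

<-transfer : ∀ {a a′ b b′ c d} → a + c ≡ b + d → a′ + c ≡ b′ + d → a < a′ → b < b′
<-transfer {c = c} {d} eq eq′ a<a′ = +-cancelʳ-< d _ _ (subst₂ _<_ eq eq′ (+-monoˡ-< c a<a′))

weight-∁-<⇔ : (f : Fin n → Fin k) {X Y : Subset n} → ∣ X ∣ ≡ ∣ Y ∣ →
              (weight f (∁ X) < weight f (∁ Y)) ⇔ (weight (opposite ∘ f) X < weight (opposite ∘ f) Y)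
weight-∁-<⇔ {k = k} f {X} {Y} ∣X∣≡∣Y∣ = mk⇔ (<-transfer eqX eqY) (<-transfer (sym eqX) (sym eqY))
  where
  eqX = weight-∁ f X
  eqY = subst (λ s → weight f (∁ Y) + suc k * s ≡ _) (sym ∣X∣≡∣Y∣) (weight-∁ f Y)

∁-involutive : (B : Subset n) → ∁ (∁ B) ≡ B
∁-involutive {n} = BooleanAlgebraProperties.¬-involutive (∪-∩-booleanAlgebra n)

∁-swap : {X Y : Subset n} → ∁ X ≡ Y → X ≡ ∁ Y
∁-swap {X = X} eq = trans (sym (∁-involutive X)) (cong ∁ eq)

module _ (M M* : Matroid n) (dual : IsDual M M*) where

  ∁-base : {B : Subset n} → IsBase M B → IsBase M* (∁ B)
  ∁-base {B} b = proj₂ (dual (∁ B)) (subst (IsBase M) (sym (∁-involutive B)) b)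

  ∁-base* : {B : Subset n} → IsBase M* B → IsBase M (∁ B)
  ∁-base* {B} = proj₁ (dual B)

  generic-dual : (f : Fin n → Fin k) → Generic M* f ⇔ Generic M (opposite ∘ f)
  generic-dual f = mk⇔ dualise undualise
    where
    open Equivalence
    dualise : Generic M* f → Generic M (opposite ∘ f)
    dualise (B₀ , b₀ , B₀-min) = ∁ B₀ , ∁-base* b₀ , λ Y bY Y≢∁B₀ →
      to (weight-∁-<⇔ f {∁ B₀} {Y} (bases-equicardinal M (∁-base* b₀) bY))
         (subst (λ Z → weight f Z < weight f (∁ Y)) (sym (∁-involutive B₀))
                (B₀-min (∁ Y) (∁-base bY) (Y≢∁B₀ ∘ ∁-swap)))
    undualise : Generic M (opposite ∘ f) → Generic M* f
    undualise (B₀ , b₀ , B₀-min) = ∁ B₀ , ∁-base b₀ , λ B bB B≢∁B₀ →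
      subst (λ Z → weight f (∁ B₀) < weight f Z) (∁-involutive B)
        (from (weight-∁-<⇔ f {B₀} {∁ B} (bases-equicardinal M b₀ (∁-base* bB)))
              (B₀-min (∁ B) (∁-base* bB) (B≢∁B₀ ∘ ∁-swap)))

sum-concatMap : (h : C → ℕ) (G : A → List C) (xs : List A) →
                sum (map h (concatMap G xs)) ≡ sum (map (λ x → sum (map h (G x))) xs)
sum-concatMap h G []       = refl
sum-concatMap h G (x ∷ xs) = begin
  sum (map h (G x ++ concatMap G xs))                         ≡⟨ cong sum (map-++ h (G x) _) ⟩
  sum (map h (G x) ++ map h (concatMap G xs))                 ≡⟨ sum-++ (map h (G x)) _ ⟩
  sum (map h (G x)) + sum (map h (concatMap G xs))            ≡⟨ cong (sum (map h (G x)) +_) (sum-concatMap h G xs) ⟩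
  sum (map h (G x)) + sum (map (λ x → sum (map h (G x))) xs)  ∎

sum-allFuns-suc : (h : (Fin (suc n) → Fin k) → ℕ) →
                  sum (map h (allFuns (suc n) k)) ≡ sum (map (λ g → ∑[ i < k ] h (i ∷ᶠ g)) (allFuns n k))
sum-allFuns-suc {n} {k} h = begin
  sum (map h (allFuns (suc n) k))
    ≡⟨ sum-concatMap h _ (allFuns n k) ⟩
  sum (map (λ g → sum (map h (map (_∷ᶠ g) (allFin k)))) (allFuns n k))
    ≡⟨ cong sum (map-cong inner (allFuns n k)) ⟩
  sum (map (λ g → ∑[ i < k ] h (i ∷ᶠ g)) (allFuns n k)) ∎
  where
  inner : ∀ g → sum (map h (map (_∷ᶠ g) (allFin k))) ≡ ∑[ i < k ] h (i ∷ᶠ g)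
  inner g = trans (cong sum (sym (map-∘ (allFin k)))) (sum-map-allFin (λ i → h (i ∷ᶠ g)))

-- Without function extensionality, (π ⟨$⟩ʳ_) ∘_ permutes allFuns only up to _≗_,
-- so the summands have to respect _≗_.
RespectsPointwise : ((Fin n → Fin k) → ℕ) → Set
RespectsPointwise h = ∀ {f g} → f ≗ g → h f ≡ h g

sum-allFuns-∘ : (π : Permutation′ k) (h : (Fin n → Fin k) → ℕ) → RespectsPointwise h →
                sum (map h (allFuns n k)) ≡ sum (map (λ f → h ((π ⟨$⟩ʳ_) ∘ f)) (allFuns n k))
sum-allFuns-∘ {n = zero}  π h resp = cong (_+ 0) (resp (λ ()))
sum-allFuns-∘ {k} {suc n} π h resp = begin
  sum (map h (allFuns (suc n) k))                               ≡⟨ sum-allFuns-suc h ⟩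
  sum (map H (allFuns n k))                                     ≡⟨ sum-allFuns-∘ π H H-resp ⟩
  sum (map (H ∘ (σ ∘_)) (allFuns n k))                          ≡⟨ cong sum (map-cong permute-head (allFuns n k)) ⟩
  sum (map (λ g → ∑[ i < k ] h (σ ∘ (i ∷ᶠ g))) (allFuns n k))  ≡⟨ sum-allFuns-suc (h ∘ (σ ∘_)) ⟨
  sum (map (h ∘ (σ ∘_)) (allFuns (suc n) k))                    ∎
  where
  σ = π ⟨$⟩ʳ_
  H : (Fin n → Fin k) → ℕ
  H g = ∑[ i < k ] h (i ∷ᶠ g)
  H-resp : RespectsPointwise H
  H-resp {f} {g} f≗g = sum-cong-≗ λ i → resp {i ∷ᶠ f} {i ∷ᶠ g} λ { zero → refl ; (suc e) → f≗g e }
  permute-head : ∀ g → H (σ ∘ g) ≡ ∑[ i < k ] h (σ ∘ (i ∷ᶠ g))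
  permute-head g = trans (sum-permute (λ i → h (i ∷ᶠ (σ ∘ g))) π) (sum-cong-≗ λ i →
    resp {σ i ∷ᶠ (σ ∘ g)} {σ ∘ (i ∷ᶠ g)} λ { zero → refl ; (suc e) → refl })

indicator : {P : Pred A 0ℓ} → Decidable P → A → ℕ
indicator P? x = if does (P? x) then 1 else 0

length-filter≡sum-indicator : {P : Pred A 0ℓ} (P? : Decidable P) (xs : List A) →
                              length (filter P? xs) ≡ sum (map (indicator P?) xs)
length-filter≡sum-indicator P? []       = refl
length-filter≡sum-indicator P? (x ∷ xs) with does (P? x)
... | true  = cong suc (length-filter≡sum-indicator P? xs)
... | false = length-filter≡sum-indicator P? xs

count-allFuns-∘ : (π : Permutation′ k) {P Q : Pred (Fin n → Fin k) 0ℓ}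
                  (P? : Decidable P) (Q? : Decidable Q) →
                  (∀ {f g} → f ≗ g → Q f → Q g) → (∀ f → P f ⇔ Q ((π ⟨$⟩ʳ_) ∘ f)) →
                  length (filter P? (allFuns n k)) ≡ length (filter Q? (allFuns n k))
count-allFuns-∘ {k} {n} π P? Q? Q-resp P⇔Q∘π = begin
  length (filter P? fs)                 ≡⟨ length-filter≡sum-indicator P? fs ⟩
  sum (map (indicator P?) fs)           ≡⟨ cong sum (map-cong P≡Q∘π fs) ⟩
  sum (map (indicator Q? ∘ (σ ∘_)) fs)  ≡⟨ sum-allFuns-∘ π (indicator Q?) indicator-resp ⟨
  sum (map (indicator Q?) fs)           ≡⟨ length-filter≡sum-indicator Q? fs ⟨
  length (filter Q? fs)                 ∎
  where
  fs = allFuns n k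
  σ = π ⟨$⟩ʳ_
  P≡Q∘π : ∀ f → indicator P? f ≡ indicator Q? (σ ∘ f)
  P≡Q∘π f = cong (if_then 1 else 0) (does-⇔ (P⇔Q∘π f) (P? f) (Q? (σ ∘ f)))
  indicator-resp : RespectsPointwise (indicator Q?)
  indicator-resp {f} {g} f≗g =
    cong (if_then 1 else 0) (does-⇔ (mk⇔ (Q-resp f≗g) (Q-resp (sym ∘ f≗g))) (Q? f) (Q? g))

fiber-cong : {f g : Fin n → Fin k} → f ≗ g → ∀ i → fiber f i ≡ fiber g i
fiber-cong {n} {f = f} {g} f≗g i = cong length (filter-≐ (λ e → f e ≟ i) (λ e → g e ≟ i)
  ((λ {e} → trans (sym (f≗g e))) , (λ {e} → trans (f≗g e))) (allFin n))

fiber-∘ : (π : Permutation′ k) (f : Fin n → Fin k) (i : Fin k) →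
          fiber ((π ⟨$⟩ʳ_) ∘ f) (π ⟨$⟩ʳ i) ≡ fiber f i
fiber-∘ {n = n} π f i = cong length (filter-≐ (λ e → π ⟨$⟩ʳ f e ≟ π ⟨$⟩ʳ i) (λ e → f e ≟ i)
  (Injection.injective (↔⇒↣ π) , cong (π ⟨$⟩ʳ_)) (allFin n))

∀-permute : (π : Permutation′ k) {P : Fin k → Set} → (∀ i → P (π ⟨$⟩ʳ i)) → ∀ i → P i
∀-permute π {P} h i = subst P (inverseʳ π) (h (π ⟨$⟩ˡ i))

fibers-∘ : (π : Permutation′ k) (f : Fin n → Fin k) {u v : Fin k → ℕ} →
           (∀ i → v (π ⟨$⟩ʳ i) ≡ u i) →
           (∀ i → fiber f i ≡ u i) ⇔ (∀ i → fiber ((π ⟨$⟩ʳ_) ∘ f) i ≡ v i)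
fibers-∘ π f v∘π≗u = mk⇔
  (λ h → ∀-permute π λ i → trans (fiber-∘ π f i) (trans (h i) (sym (v∘π≗u i))))
  (λ h i → trans (sym (fiber-∘ π f i)) (trans (h (π ⟨$⟩ʳ i)) (v∘π≗u i)))

weight-cong : {f g : Fin n → Fin k} → f ≗ g → ∀ B → weight f B ≡ weight g B
weight-cong {f = f} {g} f≗g B = trans (weight≡subsetSum f B)
  (trans (subsetSum-cong (cong value ∘ f≗g) B) (sym (weight≡subsetSum g B)))

generic-cong : (M : Matroid n) {f g : Fin n → Fin k} → f ≗ g → Generic M f → Generic M g
generic-cong M f≗g (B , b , B-min) = B , b , λ B′ b′ B′≢B →
  subst₂ _<_ (weight-cong f≗g B) (weight-cong f≗g B′) (B-min B′ b′ B′≢B)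

lookup-reverse : (xs : Vec A n) (i : Fin n) → lookup (Vec.reverse xs) (opposite i) ≡ lookup xs i
lookup-reverse (x ∷ xs) zero    rewrite reverse-∷ x xs = lookup-∷ʳ-fromℕ (Vec.reverse xs)
  where
  lookup-∷ʳ-fromℕ : ∀ {n} (ys : Vec _ n) → lookup (ys ∷ʳ x) (fromℕ n) ≡ x
  lookup-∷ʳ-fromℕ []       = refl
  lookup-∷ʳ-fromℕ (y ∷ ys) = lookup-∷ʳ-fromℕ ys
lookup-reverse (x ∷ xs) (suc i) rewrite reverse-∷ x xs =
  trans (lookup-∷ʳ-inject₁ (Vec.reverse xs) (opposite i)) (lookup-reverse xs i)
  where
  lookup-∷ʳ-inject₁ : ∀ {n} (ys : Vec _ n) (j : Fin n) → lookup (ys ∷ʳ x) (inject₁ j) ≡ lookup ys j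
  lookup-∷ʳ-inject₁ (y ∷ ys) zero    = refl
  lookup-∷ʳ-inject₁ (y ∷ ys) (suc j) = lookup-∷ʳ-inject₁ ys j

coeffF-dual : (M M* : Matroid n) → IsDual M M* →
              ∀ k (m : Vec ℕ k) → coeffF M* k m ≡ coeffF M k (Vec.reverse m)
coeffF-dual M M* dual k m = cong ℤ.+_ (count-allFuns-∘ Permutation.reverse _ _ Q-resp λ f →
  fibers-∘ Permutation.reverse f (lookup-reverse m) ×-⇔ generic-dual M M* dual f)
  where
  Q-resp : ∀ {f g} → f ≗ g →
           (∀ i → fiber f i ≡ lookup (Vec.reverse m) i) × Generic M f →
           (∀ i → fiber g i ≡ lookup (Vec.reverse m) i) × Generic M g
  Q-resp f≗g (f-fibers , f-generic) =
    (λ i → trans (sym (fiber-cong f≗g i)) (f-fibers i)) , generic-cong M f≗g f-generic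

filter-reverse : {P : Pred A 0ℓ} (P? : Decidable P) (xs : List A) →
                 filter P? (reverse xs) ≡ reverse (filter P? xs)
filter-reverse P? []       = refl
filter-reverse P? (x ∷ xs) = begin
  filter P? (reverse (x ∷ xs))              ≡⟨ cong (filter P?) (unfold-reverse x xs) ⟩
  filter P? (reverse xs ++ [ x ])           ≡⟨ filter-++ P? (reverse xs) [ x ] ⟩
  filter P? (reverse xs) ++ filter P? [ x ] ≡⟨ cong (_++ filter P? [ x ]) (filter-reverse P? xs) ⟩
  reverse (filter P? xs) ++ filter P? [ x ] ≡⟨ snoc-filtered ⟩
  reverse (filter P? (x ∷ xs))              ∎
  where
  snoc-filtered : reverse (filter P? xs) ++ filter P? [ x ] ≡ reverse (filter P? (x ∷ xs))
  snoc-filtered with does (P? x)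
  ... | true  = sym (unfold-reverse x (filter P? xs))
  ... | false = ++-identityʳ (reverse (filter P? xs))

sum-reverse : (m : Vec ℕ k) → Vec.sum (Vec.reverse m) ≡ Vec.sum m
sum-reverse m = begin
  Vec.sum (Vec.reverse m)          ≡⟨ sum-toList (Vec.reverse m) ⟩
  sum (toList (Vec.reverse m))     ≡⟨ cong sum (toList-reverse m) ⟩
  sum (reverse (toList m))         ≡⟨ sum-↭ (↭-reverse (toList m)) ⟩
  sum (toList m)                   ≡⟨ sum-toList m ⟨
  Vec.sum m                        ∎
  where
  sum-toList : ∀ {k} (v : Vec ℕ k) → Vec.sum v ≡ sum (toList v)
  sum-toList []       = refl
  sum-toList (x ∷ v) = cong (x +_) (sum-toList v)

flat-reverse : (m : Vec ℕ k) → flat (Vec.reverse m) ≡ reverse (flat m)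
flat-reverse m = trans (cong (filter _) (toList-reverse m)) (filter-reverse _ (toList m))

coeffM-cong : ∀ α {k} (m : Vec ℕ k) α′ {k′} (m′ : Vec ℕ k′) →
              (flat m ≡ α ⇔ flat m′ ≡ α′) → coeffM α m ≡ coeffM α′ m′
coeffM-cong α m α′ m′ m⇔m′ with ≡-dec ℕₚ._≟_ (flat m) α | ≡-dec ℕₚ._≟_ (flat m′) α′
... | yes _ | yes _ = refl
... | no  _ | no  _ = refl
... | yes p | no ¬p′ = contradiction (Equivalence.to m⇔m′ p) ¬p′
... | no ¬p | yes p′ = contradiction (Equivalence.from m⇔m′ p′) ¬p

coeffM-reverse : (α : Composition) (m : Vec ℕ k) → coeffM (reverse α) m ≡ coeffM α (Vec.reverse m)
coeffM-reverse α m = coeffM-cong (reverse α) m α (Vec.reverse m) (mk⇔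
  (λ m≡α* → trans (flat-reverse m) (reverse-selfInverse (sym m≡α*)))
  (λ m*≡α → sym (reverse-selfInverse (trans (sym (flat-reverse m)) m*≡α))))

coeffLin-reverse : (c : Composition → ℤ) (k : ℕ) (m : Vec ℕ k) →
                   coeffLin c reverse k m ≡ coeffLin c id k (Vec.reverse m)
coeffLin-reverse c k m = begin
  ∑over (λ α → c α ℤ.* coeffM (reverse α) m) (Vec.sum m)
    ≡⟨ cong (foldr ℤ._+_ (ℤ.+ 0))
            (map-cong (λ α → cong (c α ℤ.*_) (coeffM-reverse α m)) (compositions (Vec.sum m))) ⟩
  ∑over (λ α → c α ℤ.* coeffM α (Vec.reverse m)) (Vec.sum m)
    ≡⟨ cong (∑over (λ α → c α ℤ.* coeffM α (Vec.reverse m))) (sum-reverse m) ⟨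
  ∑over (λ α → c α ℤ.* coeffM α (Vec.reverse m)) (Vec.sum (Vec.reverse m)) ∎
  where
  ∑over : (Composition → ℤ) → ℕ → ℤ
  ∑over t d = foldr ℤ._+_ (ℤ.+ 0) (map t (compositions d))

proposition4p1 : ∀ {n} (M M* : Matroid n) → IsDual M M* →
    (c : Composition → ℤ) →
    ((coeffF M ≈ₛ coeffLin c id → coeffF M* ≈ₛ coeffLin c reverse) ×
     (coeffF M* ≈ₛ coeffLin c reverse → coeffF M ≈ₛ coeffLin c id))
proposition4p1 M M* dual c = dualise , undualise
  where
  dualise : coeffF M ≈ₛ coeffLin c id → coeffF M* ≈ₛ coeffLin c reverse
  dualise F≈ k m = begin
    coeffF M* k m                    ≡⟨ coeffF-dual M M* dual k m ⟩
    coeffF M k (Vec.reverse m)       ≡⟨ F≈ k (Vec.reverse m) ⟩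
    coeffLin c id k (Vec.reverse m)  ≡⟨ coeffLin-reverse c k m ⟨
    coeffLin c reverse k m           ∎
  undualise : coeffF M* ≈ₛ coeffLin c reverse → coeffF M ≈ₛ coeffLin c id
  undualise F*≈ k m = begin
    coeffF M k m                                     ≡⟨ cong (coeffF M k) (reverse-involutive m) ⟨
    coeffF M k (Vec.reverse (Vec.reverse m))         ≡⟨ coeffF-dual M M* dual k (Vec.reverse m) ⟨
    coeffF M* k (Vec.reverse m)                      ≡⟨ F*≈ k (Vec.reverse m) ⟩
    coeffLin c reverse k (Vec.reverse m)             ≡⟨ coeffLin-reverse c k (Vec.reverse m) ⟩
    coeffLin c id k (Vec.reverse (Vec.reverse m))    ≡⟨ cong (coeffLin c id k) (reverse-involutive m) ⟩
    coeffLin c id k m                                ∎
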